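{- Let $L$ and $L'$ be languages with value sets $\mathbf V$ and $\mathbf V'$ and let $\precsim$ be a preorder on a set containing $\mathbf V\cup\mathbf V'$. Every translation from $L$ into $L'$ that is valid up to $\precsim$ preserves $\precsim$.
   Context: Fix a set $\mathcal V$ of variables. A language $L$ consists of a set $\mathbb T_L$ of expressions and a semantic map $[\![\cdot]\!]_L:\mathbb T_L\to((\mathcal V\to\mathbf V)\to\mathbf V)$; maps $\mathcal V\to\mathbf V$ are valuations. A translation is any map $T:\mathbb T_L\to\mathbb T_{L'}$. A semantic translation is $R\subseteq\mathbf V'\times\mathbf V$ such that every $v\in\mathbf V$ has some $v'\in\mathbf V'$ with $v'Rv$. $T$ is correct w.r.t. $R$ if $[\![T(E)]\!]_{L'}(\eta)\,R\,[\![E]\!]_L(\rho)$ for all $E\in\mathbb T_L$ and all valuations with $\eta(X)R\rho(X)$ for all $X\in\mathcal V$. $T$ is valid up to $\precsim$ if it is correct w.r.t. some semantic translation $R\subseteq\,\precsim$. $T$ preserves $\precsim$ if there is a map $\mathbf T:\mathbf V\to\mathbf V'$ with $\mathbf T(v)\precsim v$ for all $v\in\mathbf V$ and $[\![T(E)]\!]_{L'}(\mathbf T\circ\rho)\precsim[\![E]\!]_L(\rho)$ for all $E\in\mathbb T_L$ and all $\rho:\mathcal V\to\mathbf V$. -}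

module Defs where

open import Level using (Level; _⊔_; suc)
open import Data.Product using (Σ; ∃; _×_; _,_)
open import Relation.Binary.Core using (Rel; REL)
open import Relation.Binary.Structures using (IsPreorder)
open import Relation.Binary.PropositionalEquality using (_≡_)

record Language (a : Level) (Var : Set a) (Val : Set a) : Set (suc a) where
  field
    Expr : Set a
    ⟦_⟧  : Expr → (Var → Val) → Val

open Language public

module _ {a : Level} {Var : Set a} {V V′ : Set a}
         (L : Language a Var V) (L′ : Language a Var V′) where

  Translation : Set a
  Translation = Expr L → Expr L′

  IsSemanticTranslation : REL V′ V a → Set a
  IsSemanticTranslation R = (v : V) → Σ V′ (λ v′ → R v′ v)

  CorrectWrt : Translation → REL V′ V a → Set a
  CorrectWrt T R =
    (E : Expr L) (η : Var → V′) (ρ : Var → V) →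
    ((X : Var) → R (η X) (ρ X)) →
    R (⟦ L′ ⟧ (T E) η) (⟦ L ⟧ E ρ)

  module _ {U : Set a} (ι : V → U) (ι′ : V′ → U) (_≾_ : Rel U a) where

    -- T is valid up to ≾: correct w.r.t. some semantic translation R ⊆ ≾
    -- (V and V′ are regarded as subsets of U via ι and ι′).
    ValidUpTo : Translation → Set (suc a)
    ValidUpTo T =
      Σ (REL V′ V a) λ R →
        IsSemanticTranslation R ×
        (∀ {v′ v} → R v′ v → ι′ v′ ≾ ι v) ×
        CorrectWrt T R

    Preserves : Translation → Set a
    Preserves T =
      Σ (V → V′) λ 𝐓 →
        ((v : V) → ι′ (𝐓 v) ≾ ι v) ×
        ((E : Expr L) (ρ : Var → V) →
           ι′ (⟦ L′ ⟧ (T E) (λ X → 𝐓 (ρ X))) ≾ ι (⟦ L ⟧ E ρ))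

-- Totality of the semantic translation R picks, for each value v, a witness 𝐓 v with
-- 𝐓 v R v; correctness applied to the valuation 𝐓 ∘ ρ gives ⟦ T E ⟧ (𝐓 ∘ ρ) R ⟦ E ⟧ ρ,
-- and R ⊆ ≾ turns both facts into the required ≾-bounds.
module Submission where

open import Defs
open import Level using (Level)
open import Relation.Binary.Core using (Rel; REL)
open import Relation.Binary.Structures using (IsPreorder)
open import Relation.Binary.PropositionalEquality using (_≡_)
open import Data.Product using (_,_; proj₁; proj₂)
open import Function using (_∘_)

module _ {a : Level} {Var V V′ : Set a}
         (L : Language a Var V) (L′ : Language a Var V′)
         {R : REL V′ V a} (total : IsSemanticTranslation L L′ R) where

  witness : V → V′
  witness = proj₁ ∘ total

  witness-related : (v : V) → R (witness v) v
  witness-related = proj₂ ∘ total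

  correct⇒related-on-witness : (T : Translation L L′) → CorrectWrt L L′ T R →
    (E : Expr L) (ρ : Var → V) → R (⟦ L′ ⟧ (T E) (witness ∘ ρ)) (⟦ L ⟧ E ρ)
  correct⇒related-on-witness T correct E ρ =
    correct E (witness ∘ ρ) ρ (witness-related ∘ ρ)

proposition7 : {a : Level} {Var V V′ U : Set a}
    (L : Language a Var V) (L′ : Language a Var V′)
    (ι : V → U) (ι′ : V′ → U) (_≾_ : Rel U a) →
    IsPreorder _≡_ _≾_ →
    (T : Translation L L′) →
    ValidUpTo L L′ ι ι′ _≾_ T → Preserves L L′ ι ι′ _≾_ T
proposition7 L L′ ι ι′ _≾_ _ T (R , total , R⊆≾ , correct) =
  witness L L′ total ,
  R⊆≾ ∘ witness-related L L′ total ,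
  λ E ρ → R⊆≾ (correct⇒related-on-witness L L′ total T correct E ρ)
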